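{- For every positive integer $k$ and every nonnegative integer $n$, $$\det\left(\binom{i+j+k}{i-j+1}\right)_{i,j=0}^{n-1}=\det\left(\binom{j+k}{i-j+1}\right)_{i,j=0}^{n-1}=C_n^{(k)}=\frac{k}{2n+k}\binom{2n+k}{n}.$$ In particular ($k=1$), $\det\left(\binom{i+j+1}{i-j+1}\right)_{i,j=0}^{n-1}=C_n=\frac{1}{n+1}\binom{2n}{n}$.
   Context: Binomial coefficients $\binom{a}{b}$ with $a\ge 0$ are the usual ones, with $\binom{a}{b}=0$ if $b<0$ or $b>a$. The determinant of a $0\times 0$ matrix is $1$. The numbers $C_n^{(k)}=\frac{k}{2n+k}\binom{2n+k}{n}$ are the coefficients of the $k$-th power of the Catalan generating function: $\sum_{n\ge0}C_n^{(k)}z^n=\left(\sum_{n\ge0}C_nz^n\right)^k$ with $C_n=\frac{1}{n+1}\binom{2n}{n}$. -}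

module Defs where

open import Data.Nat as ℕ using (ℕ; zero; suc; _≤?_; _∸_)
open import Data.Nat.Combinatorics using (_C_)
open import Data.Integer as ℤ using (ℤ; +_; -_; _+_; _*_; 0ℤ; 1ℤ)
open import Data.Fin using (Fin; zero; suc; punchIn; toℕ)
open import Relation.Nullary using (yes; no)

Matrix : ℕ → Set
Matrix n = Fin n → Fin n → ℤ

sign : ℕ → ℤ
sign zero = 1ℤ
sign (suc zero) = - 1ℤ
sign (suc (suc i)) = sign i

minor : ∀ {n} → Matrix (suc n) → Fin (suc n) → Matrix n
minor M j r c = M (suc r) (punchIn j c)

sumFin : ∀ n → (Fin n → ℤ) → ℤ
sumFin zero f = 0ℤ
sumFin (suc n) f = f zero + sumFin n (λ i → f (suc i))

det : ∀ n → Matrix n → ℤ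
det zero M = 1ℤ
det (suc n) M = sumFin (suc n) (λ j → sign (toℕ j) * (M zero j * det n (minor M j)))

-- Binomial coefficient binom a b for a ∈ ℕ and integer b = i - j + 1,
-- given as (i + 1) - j with i j ∈ ℕ; zero when b < 0 (and when b > a, via _C_).
binomShift : ℕ → ℕ → ℕ → ℤ
binomShift a i j with j ≤? suc i
... | yes _ = + (a C (suc i ∸ j))
... | no _  = 0ℤ

A : ℕ → (n : ℕ) → Matrix n
A k n i j = binomShift (toℕ i ℕ.+ toℕ j ℕ.+ k) (toℕ i) (toℕ j)

B : ℕ → (n : ℕ) → Matrix n
B k n i j = binomShift (toℕ j ℕ.+ k) (toℕ i) (toℕ j)

-- Both matrices are lower Hessenberg with ones on the superdiagonal, and deleting the
-- top row together with the first or the second column leaves a matrix of the same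
-- shape whose parameter k is shifted (by 1 for B, by 2 for A) and whose first column
-- is arbitrary. Expanding along the first row therefore evaluates the determinant
-- with first column g as the alternating sum Σᵢ (-1)^i g(i) C^{(k+i)}_{n-i} (for A,
-- C^{(k+2i)}_{n-i}). For the actual first columns these sums collapse by Pascal's
-- rule, which is the coefficientwise form of c(1 - zc) = 1 and 1 + zc² = c for the
-- Catalan series c. The closed form is checked against the recurrence
-- C^{(k+1)}_{n+1} = C^{(k)}_{n+1} + C^{(k+2)}_n.

module Submission where

module CatalanPowers where

  open import Data.Nat using (ℕ; zero; suc; _+_; _*_)
  open import Data.Nat.Properties using (*-zeroʳ; *-identityˡ; *-identityʳ; +-suc; m≤m+n; m+n∸m≡n; *-cancelˡ-≡; +-cancelʳ-≡)
  open import Data.Nat.Combinatorics using (_C_; nCk+nC[k+1]≡[n+1]C[k+1]; nC1≡n; nCk≡nC[n∸k])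
  open import Data.Nat.Tactic.RingSolver using (solve-∀)
  open import Relation.Binary.PropositionalEquality
  open ≡-Reasoning

  -- catalanPow k n = C_n^{(k)}; the recurrence is c^{k+1} = c^k + z c^{k+2}.
  catalanPow : ℕ → ℕ → ℕ
  catalanPow k       zero    = 1
  catalanPow zero    (suc n) = 0
  catalanPow (suc k) (suc n) = catalanPow k (suc n) + catalanPow (suc (suc k)) n

  [k+1]*[n+1]C[k+1]≡[n+1]*nCk : ∀ n k → suc k * (suc n C suc k) ≡ suc n * (n C k)
  [k+1]*[n+1]C[k+1]≡[n+1]*nCk zero    zero    = refl
  [k+1]*[n+1]C[k+1]≡[n+1]*nCk zero    (suc k) = *-zeroʳ (suc (suc k))
  [k+1]*[n+1]C[k+1]≡[n+1]*nCk (suc n) zero    =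
    trans (*-identityˡ _) (trans (nC1≡n (suc (suc n))) (sym (*-identityʳ (suc (suc n)))))
  [k+1]*[n+1]C[k+1]≡[n+1]*nCk (suc n) (suc k) = begin
    suc (suc k) * (suc (suc n) C suc (suc k))
      ≡⟨ cong (suc (suc k) *_) (sym (nCk+nC[k+1]≡[n+1]C[k+1] (suc n) (suc k))) ⟩
    suc (suc k) * (x + y)
      ≡⟨ distribute k x y ⟩
    x + suc k * x + suc (suc k) * y
      ≡⟨ cong₂ (λ u v → x + u + v) ([k+1]*[n+1]C[k+1]≡[n+1]*nCk n k) ([k+1]*[n+1]C[k+1]≡[n+1]*nCk n (suc k)) ⟩
    x + suc n * (n C k) + suc n * (n C suc k)
      ≡⟨ collect x (suc n) (n C k) (n C suc k) ⟩
    x + suc n * (n C k + n C suc k)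
      ≡⟨ cong (λ z → x + suc n * z) (nCk+nC[k+1]≡[n+1]C[k+1] n k) ⟩
    suc (suc n) * x ∎
    where
    x = suc n C suc k
    y = suc n C suc (suc k)
    distribute : ∀ k x y → suc (suc k) * (x + y) ≡ x + suc k * x + suc (suc k) * y
    distribute = solve-∀
    collect : ∀ x m a b → x + m * a + m * b ≡ x + m * (a + b)
    collect = solve-∀

  [a+b]Ca≡[a+b]Cb : ∀ a b → (a + b) C a ≡ (a + b) C b
  [a+b]Ca≡[a+b]Cb a b = trans (nCk≡nC[n∸k] (m≤m+n a b)) (cong ((a + b) C_) (m+n∸m≡n a b))

  [k+1]*[k+1+m]C[k+1]≡[m+1]*[k+1+m]Ck : ∀ k m → suc k * ((suc k + m) C suc k) ≡ suc m * ((suc k + m) C k)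
  [k+1]*[k+1+m]C[k+1]≡[m+1]*[k+1+m]Ck k m = begin
    suc k * (suc (k + m) C suc k)   ≡⟨ [k+1]*[n+1]C[k+1]≡[n+1]*nCk (k + m) k ⟩
    suc (k + m) * ((k + m) C k)     ≡⟨ cong (suc (k + m) *_) ([a+b]Ca≡[a+b]Cb k m) ⟩
    suc (k + m) * ((k + m) C m)     ≡⟨ [k+1]*[n+1]C[k+1]≡[n+1]*nCk (k + m) m ⟨
    suc m * (suc (k + m) C suc m)   ≡⟨ cong (λ z → suc m * (z C suc m)) (sym (+-suc k m)) ⟩
    suc m * ((k + suc m) C suc m)   ≡⟨ cong (suc m *_) ([a+b]Ca≡[a+b]Cb k (suc m)) ⟨
    suc m * ((k + suc m) C k)       ≡⟨ cong (λ z → suc m * (z C k)) (+-suc k m) ⟩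
    suc m * (suc (k + m) C k)       ∎

  -- The ratio term 2(n+1)b is added on both sides so that the computation stays in ℕ;
  -- then N ≠ 0 is cancelled.
  catalanPow-closedForm-algebra : ∀ n k {a b c₁ c₂} → let N = 2 * suc n + k in
    N * c₁ ≡ k * b → N * c₂ ≡ (2 + k) * a → suc n * b ≡ suc (suc (n + k)) * a →
    suc N * (c₁ + c₂) ≡ suc k * (a + b)
  catalanPow-closedForm-algebra n k {a} {b} {c₁} {c₂} Nc₁ Nc₂ ratio =
    *-cancelˡ-≡ _ _ N (+-cancelʳ-≡ (2 * (suc n * b)) _ _ (begin
      N * (suc N * (c₁ + c₂)) + 2 * (suc n * b)          ≡⟨ regroup N c₁ c₂ (2 * (suc n * b)) ⟩
      suc N * (N * c₁ + N * c₂) + 2 * (suc n * b)        ≡⟨ cong₂ (λ u v → suc N * (u + v) + 2 * (suc n * b)) Nc₁ Nc₂ ⟩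
      suc N * (k * b + (2 + k) * a) + 2 * (suc n * b)    ≡⟨ identity n k a b ⟩
      N * (suc k * (a + b)) + 2 * (suc (suc (n + k)) * a) ≡⟨ cong (λ u → N * (suc k * (a + b)) + 2 * u) ratio ⟨
      N * (suc k * (a + b)) + 2 * (suc n * b)            ∎))
    where
    N = 2 * suc n + k
    regroup : ∀ N c₁ c₂ r → N * (suc N * (c₁ + c₂)) + r ≡ suc N * (N * c₁ + N * c₂) + r
    regroup = solve-∀
    identity : ∀ n k a b → let N = 2 * suc n + k in
      suc N * (k * b + (2 + k) * a) + 2 * (suc n * b) ≡ N * (suc k * (a + b)) + 2 * (suc (suc (n + k)) * a)
    identity = solve-∀

  catalanPow-closedForm-suc : ∀ n k →
    (2 * suc n + k) * catalanPow k (suc n) ≡ k * ((2 * suc n + k) C suc n) →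
    (2 * n + suc (suc k)) * catalanPow (suc (suc k)) n ≡ suc (suc k) * ((2 * n + suc (suc k)) C n) →
    (2 * suc n + suc k) * catalanPow (suc k) (suc n) ≡ suc k * ((2 * suc n + suc k) C suc n)
  catalanPow-closedForm-suc n k IH₁ IH₂ = begin
    (2 * suc n + suc k) * catalanPow (suc k) (suc n)            ≡⟨ cong (_* catalanPow (suc k) (suc n)) N+1≡ ⟩
    suc N * (catalanPow k (suc n) + catalanPow (suc (suc k)) n) ≡⟨ catalanPow-closedForm-algebra n k IH₁ IH₂′ ratio ⟩
    suc k * (N C n + N C suc n)                                 ≡⟨ cong (suc k *_) (nCk+nC[k+1]≡[n+1]C[k+1] N n) ⟩
    suc k * (suc N C suc n)                                     ≡⟨ cong (λ z → suc k * (z C suc n)) N+1≡ ⟨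
    suc k * ((2 * suc n + suc k) C suc n)                       ∎
    where
    N = 2 * suc n + k
    N+1≡ : 2 * suc n + suc k ≡ suc N
    N+1≡ = +-suc (2 * suc n) k
    IH₂′ : N * catalanPow (suc (suc k)) n ≡ (2 + k) * (N C n)
    IH₂′ = subst (λ M → M * catalanPow (suc (suc k)) n ≡ (2 + k) * (M C n)) (eq n k) IH₂
      where eq : ∀ n k → 2 * n + suc (suc k) ≡ 2 * suc n + k
            eq = solve-∀
    ratio : suc n * (N C suc n) ≡ suc (suc (n + k)) * (N C n)
    ratio = subst (λ M → suc n * (M C suc n) ≡ suc (suc (n + k)) * (M C n)) (eq n k)
              ([k+1]*[k+1+m]C[k+1]≡[m+1]*[k+1+m]Ck n (suc (n + k)))
      where eq : ∀ n k → suc n + suc (n + k) ≡ 2 * suc n + k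
            eq = solve-∀

  catalanPow-closedForm : ∀ k n → (2 * n + k) * catalanPow k n ≡ k * ((2 * n + k) C n)
  catalanPow-closedForm k       zero    = refl
  catalanPow-closedForm zero    (suc n) = *-zeroʳ (2 * suc n + 0)
  catalanPow-closedForm (suc k) (suc n) =
    catalanPow-closedForm-suc n k (catalanPow-closedForm k (suc n)) (catalanPow-closedForm (suc (suc k)) n)


open import Defs
open import Data.Nat as ℕ using (ℕ; zero; suc; _≤_; s≤s)
import Data.Nat.Properties as ℕₚ
open import Data.Nat.Combinatorics using (_C_; nCk+nC[k+1]≡[n+1]C[k+1]; nCn≡1)
open import Data.Integer as ℤ using (ℤ; +_; -_; _+_; _-_; _*_; 0ℤ; 1ℤ)
open import Data.Integer.Properties using (pos-+; pos-*; i-j≡0⇒i≡j; *-identityˡ; *-zeroˡ; *-zeroʳ; +-comm)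
open import Data.Integer.Tactic.RingSolver using (solve-∀)
import Data.Nat.Tactic.RingSolver as ℕ-Solver
open import Data.Fin using (Fin; zero; suc; toℕ; punchIn)
open import Data.Product using (_×_; _,_)
open import Function using (_∘_)
open import Relation.Nullary using (yes; no; contradiction)
open import Relation.Binary.PropositionalEquality
open ≡-Reasoning
open CatalanPowers using (catalanPow; catalanPow-closedForm)

catalanPow-recurrence : ∀ m n → + catalanPow (suc m) (suc n) - + catalanPow (suc (suc m)) n ≡ + catalanPow m (suc n)
catalanPow-recurrence m n = begin
  + catalanPow (suc m) (suc n) - y           ≡⟨ cong (_- y) (pos-+ (catalanPow m (suc n)) (catalanPow (suc (suc m)) n)) ⟩
  (+ catalanPow m (suc n) + y) - y           ≡⟨ cancel (+ catalanPow m (suc n)) y ⟩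
  + catalanPow m (suc n)                     ∎
  where
  y = + catalanPow (suc (suc m)) n
  cancel : ∀ x y → (x + y) - y ≡ x
  cancel = solve-∀

shiftRight : (ℕ → ℤ) → ℕ → ℤ
shiftRight g zero    = 0ℤ
shiftRight g (suc i) = g i

module _ (σ : ℕ → ℕ) where

  -- altSum σ g k n = Σ_{i ≤ n} (-1)^i g(i) C^{(σ^i k)}_{n-i}
  altSum : (ℕ → ℤ) → ℕ → ℕ → ℤ
  altSum g k zero    = g 0
  altSum g k (suc n) = g 0 * + catalanPow k (suc n) - altSum (g ∘ suc) (σ k) n

  altSum-cong : ∀ {g h} → (∀ i → g i ≡ h i) → ∀ k n → altSum g k n ≡ altSum h k n
  altSum-cong g≗h k zero    = g≗h 0
  altSum-cong g≗h k (suc n) =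
    cong₂ (λ a b → a * + catalanPow k (suc n) - b) (g≗h 0) (altSum-cong (g≗h ∘ suc) (σ k) n)

  altSum-+ : ∀ g h k n → altSum (λ i → g i + h i) k n ≡ altSum g k n + altSum h k n
  altSum-+ g h k zero    = refl
  altSum-+ g h k (suc n) = begin
    (g 0 + h 0) * t - altSum (λ i → g (suc i) + h (suc i)) (σ k) n
      ≡⟨ cong (λ z → (g 0 + h 0) * t - z) (altSum-+ (g ∘ suc) (h ∘ suc) (σ k) n) ⟩
    (g 0 + h 0) * t - (altSum (g ∘ suc) (σ k) n + altSum (h ∘ suc) (σ k) n)
      ≡⟨ distrib (g 0) (h 0) t _ _ ⟩
    (g 0 * t - altSum (g ∘ suc) (σ k) n) + (h 0 * t - altSum (h ∘ suc) (σ k) n) ∎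
    where
    t = + catalanPow k (suc n)
    distrib : ∀ a b t x y → (a + b) * t - (x + y) ≡ (a * t - x) + (b * t - y)
    distrib = solve-∀

  altSum-shiftRight : ∀ g k n → altSum (shiftRight g) k (suc n) ≡ - altSum g (σ k) n
  altSum-shiftRight g k n = vanish (+ catalanPow k (suc n)) (altSum g (σ k) n)
    where
    vanish : ∀ t x → 0ℤ * t - x ≡ - x
    vanish = solve-∀

  altSum-tail : ∀ g k n → g 0 ≡ 1ℤ → altSum g k (suc n) ≡ 0ℤ → altSum (g ∘ suc) (σ k) n ≡ + catalanPow k (suc n)
  altSum-tail g k n g0≡1 vanishes = sym (i-j≡0⇒i≡j _ _ (begin
    t - altSum (g ∘ suc) (σ k) n         ≡⟨ cong (_- altSum (g ∘ suc) (σ k) n) (*-identityˡ t) ⟨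
    1ℤ * t - altSum (g ∘ suc) (σ k) n    ≡⟨ cong (λ a → a * t - altSum (g ∘ suc) (σ k) n) g0≡1 ⟨
    altSum g k (suc n)                  ≡⟨ vanishes ⟩
    0ℤ ∎))
    where t = + catalanPow k (suc n)

  altSum-zero : ∀ k n → altSum (λ _ → 0ℤ) k n ≡ 0ℤ
  altSum-zero k zero    = refl
  altSum-zero k (suc n) = begin
    0ℤ * t - altSum (λ _ → 0ℤ) (σ k) n ≡⟨ cong (λ z → 0ℤ * t - z) (altSum-zero (σ k) n) ⟩
    0ℤ * t - 0ℤ                        ≡⟨ vanish t ⟩
    0ℤ                                 ∎
    where
    t = + catalanPow k (suc n)
    vanish : ∀ t → 0ℤ * t - 0ℤ ≡ 0ℤ
    vanish = solve-∀

binomialRow : ℕ → ℕ → ℤ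
binomialRow k i = + (k C i)

binomialRow-suc : ∀ k i → binomialRow (suc k) i ≡ binomialRow k i + shiftRight (binomialRow k) i
binomialRow-suc k zero    = refl
binomialRow-suc k (suc i) = begin
  + (suc k C suc i)                ≡⟨ cong +_ (nCk+nC[k+1]≡[n+1]C[k+1] k i) ⟨
  + (k C i ℕ.+ k C suc i)          ≡⟨ pos-+ (k C i) (k C suc i) ⟩
  + (k C i) + + (k C suc i)        ≡⟨ +-comm (+ (k C i)) (+ (k C suc i)) ⟩
  + (k C suc i) + + (k C i)        ∎

-- The coefficients of c^{m+k} (1 - zc)^k = c^m.
altSum-binomialRow : ∀ k m n → altSum suc (binomialRow k) (m ℕ.+ k) n ≡ + catalanPow m n
altSum-binomialRow zero    m zero    = refl
altSum-binomialRow zero    m (suc n) = begin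
  1ℤ * + catalanPow (m ℕ.+ 0) (suc n) - altSum suc (λ _ → 0ℤ) (suc (m ℕ.+ 0)) n
    ≡⟨ cong₂ (λ j z → 1ℤ * + catalanPow j (suc n) - z) (ℕₚ.+-identityʳ m) (altSum-zero suc _ n) ⟩
  1ℤ * + catalanPow m (suc n) - 0ℤ
    ≡⟨ simplify (+ catalanPow m (suc n)) ⟩
  + catalanPow m (suc n) ∎
  where
  simplify : ∀ t → 1ℤ * t - 0ℤ ≡ t
  simplify = solve-∀
altSum-binomialRow (suc k) m zero    = refl
altSum-binomialRow (suc k) m (suc n) = begin
  altSum suc (binomialRow (suc k)) (m ℕ.+ suc k) (suc n)
    ≡⟨ cong (λ j → altSum suc (binomialRow (suc k)) j (suc n)) (ℕₚ.+-suc m k) ⟩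
  altSum suc (binomialRow (suc k)) (suc m ℕ.+ k) (suc n)
    ≡⟨ altSum-cong suc (binomialRow-suc k) (suc m ℕ.+ k) (suc n) ⟩
  altSum suc (λ i → binomialRow k i + shiftRight (binomialRow k) i) (suc m ℕ.+ k) (suc n)
    ≡⟨ altSum-+ suc (binomialRow k) (shiftRight (binomialRow k)) (suc m ℕ.+ k) (suc n) ⟩
  altSum suc (binomialRow k) (suc m ℕ.+ k) (suc n) + altSum suc (shiftRight (binomialRow k)) (suc m ℕ.+ k) (suc n)
    ≡⟨ cong₂ _+_ (altSum-binomialRow k (suc m) (suc n)) (altSum-shiftRight suc (binomialRow k) (suc m ℕ.+ k) n) ⟩
  + catalanPow (suc m) (suc n) - altSum suc (binomialRow k) (suc (suc m) ℕ.+ k) n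
    ≡⟨ cong (λ z → + catalanPow (suc m) (suc n) - z) (altSum-binomialRow k (suc (suc m)) n) ⟩
  + catalanPow (suc m) (suc n) - + catalanPow (suc (suc m)) n
    ≡⟨ catalanPow-recurrence m n ⟩
  + catalanPow m (suc n) ∎

diagonalBinomial : ℕ → ℕ → ℤ
diagonalBinomial b i = + ((i ℕ.+ b) C i)

diagonalBinomial-zero : ∀ i → diagonalBinomial 0 i ≡ 1ℤ
diagonalBinomial-zero i = cong +_ (trans (cong (_C i) (ℕₚ.+-identityʳ i)) (nCn≡1 i))

diagonalBinomial-suc : ∀ b i → diagonalBinomial (suc b) i ≡ diagonalBinomial b i + shiftRight (diagonalBinomial (suc b)) i
diagonalBinomial-suc b zero    = refl
diagonalBinomial-suc b (suc i) = begin
  + (suc (i ℕ.+ suc b) C suc i)                        ≡⟨ cong +_ (nCk+nC[k+1]≡[n+1]C[k+1] (i ℕ.+ suc b) i) ⟨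
  + ((i ℕ.+ suc b) C i ℕ.+ (i ℕ.+ suc b) C suc i)      ≡⟨ pos-+ ((i ℕ.+ suc b) C i) ((i ℕ.+ suc b) C suc i) ⟩
  + ((i ℕ.+ suc b) C i) + + ((i ℕ.+ suc b) C suc i)    ≡⟨ +-comm (+ ((i ℕ.+ suc b) C i)) (+ ((i ℕ.+ suc b) C suc i)) ⟩
  + ((i ℕ.+ suc b) C suc i) + + ((i ℕ.+ suc b) C i)    ≡⟨ cong (λ j → + (j C suc i) + + ((i ℕ.+ suc b) C i)) (ℕₚ.+-suc i b) ⟩
  + (suc (i ℕ.+ b) C suc i) + + ((i ℕ.+ suc b) C i)    ∎

-- The coefficients of c^{m+b+1} (1 + zc²)^{-(b+1)} = c^m.
altSum-diagonalBinomial : ∀ b m n → altSum (2 ℕ.+_) (diagonalBinomial b) (m ℕ.+ suc b) n ≡ + catalanPow m n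
altSum-diagonalBinomial zero    m zero    = refl
altSum-diagonalBinomial zero    m (suc n) = begin
  1ℤ * + catalanPow (m ℕ.+ 1) (suc n) - altSum (2 ℕ.+_) (diagonalBinomial 0 ∘ suc) (2 ℕ.+ (m ℕ.+ 1)) n
    ≡⟨ cong (λ z → 1ℤ * + catalanPow (m ℕ.+ 1) (suc n) - z)
         (altSum-cong (2 ℕ.+_) (λ i → trans (diagonalBinomial-zero (suc i)) (sym (diagonalBinomial-zero i))) _ n) ⟩
  1ℤ * + catalanPow (m ℕ.+ 1) (suc n) - altSum (2 ℕ.+_) (diagonalBinomial 0) (suc (suc m) ℕ.+ 1) n
    ≡⟨ cong₂ (λ j z → 1ℤ * + catalanPow j (suc n) - z) (ℕₚ.+-comm m 1) (altSum-diagonalBinomial 0 (suc (suc m)) n) ⟩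
  1ℤ * + catalanPow (suc m) (suc n) - + catalanPow (suc (suc m)) n
    ≡⟨ cong (_- + catalanPow (suc (suc m)) n) (*-identityˡ (+ catalanPow (suc m) (suc n))) ⟩
  + catalanPow (suc m) (suc n) - + catalanPow (suc (suc m)) n
    ≡⟨ catalanPow-recurrence m n ⟩
  + catalanPow m (suc n) ∎
altSum-diagonalBinomial (suc b) m zero    = refl
altSum-diagonalBinomial (suc b) m (suc n) = begin
  altSum (2 ℕ.+_) (diagonalBinomial (suc b)) K (suc n)
    ≡⟨ altSum-cong (2 ℕ.+_) (diagonalBinomial-suc b) K (suc n) ⟩
  altSum (2 ℕ.+_) (λ i → diagonalBinomial b i + shiftRight (diagonalBinomial (suc b)) i) K (suc n)
    ≡⟨ altSum-+ (2 ℕ.+_) (diagonalBinomial b) (shiftRight (diagonalBinomial (suc b))) K (suc n) ⟩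
  altSum (2 ℕ.+_) (diagonalBinomial b) K (suc n) + altSum (2 ℕ.+_) (shiftRight (diagonalBinomial (suc b))) K (suc n)
    ≡⟨ cong₂ _+_ (cong (λ j → altSum (2 ℕ.+_) (diagonalBinomial b) j (suc n)) (ℕₚ.+-suc m (suc b)))
                 (altSum-shiftRight (2 ℕ.+_) (diagonalBinomial (suc b)) K n) ⟩
  altSum (2 ℕ.+_) (diagonalBinomial b) (suc m ℕ.+ suc b) (suc n) - altSum (2 ℕ.+_) (diagonalBinomial (suc b)) (2 ℕ.+ K) n
    ≡⟨ cong₂ _-_ (altSum-diagonalBinomial b (suc m) (suc n)) (altSum-diagonalBinomial (suc b) (suc (suc m)) n) ⟩
  + catalanPow (suc m) (suc n) - + catalanPow (suc (suc m)) n
    ≡⟨ catalanPow-recurrence m n ⟩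
  + catalanPow m (suc n) ∎
  where K = m ℕ.+ suc (suc b)

sumFin-cong : ∀ n {f g : Fin n → ℤ} → (∀ i → f i ≡ g i) → sumFin n f ≡ sumFin n g
sumFin-cong zero    f≗g = refl
sumFin-cong (suc n) f≗g = cong₂ _+_ (f≗g zero) (sumFin-cong n (f≗g ∘ suc))

sumFin-zero : ∀ n {f : Fin n → ℤ} → (∀ i → f i ≡ 0ℤ) → sumFin n f ≡ 0ℤ
sumFin-zero zero    f≗0 = refl
sumFin-zero (suc n) f≗0 = cong₂ _+_ (f≗0 zero) (sumFin-zero n (f≗0 ∘ suc))

det-cong : ∀ n {M N : Matrix n} → (∀ i j → M i j ≡ N i j) → det n M ≡ det n N
det-cong zero    M≗N = refl
det-cong (suc n) M≗N = sumFin-cong (suc n) λ j →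
  cong₂ (λ a d → sign (toℕ j) * (a * d)) (M≗N zero j) (det-cong n (λ r c → M≗N (suc r) (punchIn j c)))

det-hessenberg : ∀ n (M : Matrix (suc (suc n))) → M zero (suc zero) ≡ 1ℤ → (∀ j → M zero (suc (suc j)) ≡ 0ℤ) →
  det (suc (suc n)) M ≡ M zero zero * det (suc n) (minor M zero) - det (suc n) (minor M (suc zero))
det-hessenberg n M M₀₁≡1 M₀ⱼ≡0 = begin
  1ℤ * (M zero zero * d₀) + (- 1ℤ * (M zero (suc zero) * d₁) + rest)
    ≡⟨ cong₂ (λ a r → 1ℤ * (M zero zero * d₀) + (- 1ℤ * (a * d₁) + r)) M₀₁≡1 (sumFin-zero n vanish) ⟩
  1ℤ * (M zero zero * d₀) + (- 1ℤ * (1ℤ * d₁) + 0ℤ)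
    ≡⟨ simplify (M zero zero) d₀ d₁ ⟩
  M zero zero * d₀ - d₁ ∎
  where
  d₀ = det (suc n) (minor M zero)
  d₁ = det (suc n) (minor M (suc zero))
  term : Fin n → ℤ
  term j = sign (toℕ j) * (M zero (suc (suc j)) * det (suc n) (minor M (suc (suc j))))
  rest = sumFin n term
  vanish : ∀ j → term j ≡ 0ℤ
  vanish j = begin
    sign (toℕ j) * (M zero (suc (suc j)) * det (suc n) (minor M (suc (suc j))))
      ≡⟨ cong (λ a → sign (toℕ j) * (a * det (suc n) (minor M (suc (suc j))))) (M₀ⱼ≡0 j) ⟩
    sign (toℕ j) * (0ℤ * det (suc n) (minor M (suc (suc j))))
      ≡⟨ cong (sign (toℕ j) *_) (*-zeroˡ (det (suc n) (minor M (suc (suc j))))) ⟩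
    sign (toℕ j) * 0ℤ
      ≡⟨ *-zeroʳ (sign (toℕ j)) ⟩
    0ℤ ∎
  simplify : ∀ a d₀ d₁ → 1ℤ * (a * d₀) + (- 1ℤ * (1ℤ * d₁) + 0ℤ) ≡ a * d₀ - d₁
  simplify = solve-∀

module HessenbergFamily
  (σ : ℕ → ℕ)
  (col : ℕ → ℕ → ℕ → ℤ)
  (col-0-0   : ∀ k → col k 0 0 ≡ 1ℤ)
  (col-0-suc : ∀ k c → col k 0 (suc c) ≡ 0ℤ)
  (col-shift : ∀ k r c → col k (suc r) (suc c) ≡ col (σ k) r c)
  where

  entry : (ℕ → ℤ) → ℕ → ℕ → ℕ → ℤ
  entry g k r zero    = g r
  entry g k r (suc c) = col k r c

  family : (ℕ → ℤ) → ℕ → (n : ℕ) → Matrix n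
  family g k n i j = entry g k (toℕ i) (toℕ j)

  nextColumn : ℕ → ℕ → ℤ
  nextColumn k r = col k (suc r) 0

  minor-family-zero : ∀ n g k i j →
    minor (family g k (suc (suc n))) zero i j ≡ family (nextColumn k) (σ k) (suc n) i j
  minor-family-zero n g k i zero    = refl
  minor-family-zero n g k i (suc j) = col-shift k (toℕ i) (toℕ j)

  minor-family-one : ∀ n g k i j →
    minor (family g k (suc (suc n))) (suc zero) i j ≡ family (g ∘ suc) (σ k) (suc n) i j
  minor-family-one n g k i zero    = refl
  minor-family-one n g k i (suc j) = col-shift k (toℕ i) (toℕ j)

  det-family : (∀ k n → altSum σ (nextColumn k) (σ (σ k)) n ≡ + catalanPow (σ k) (suc n)) →
    ∀ n g k → det (suc n) (family g k (suc n)) ≡ altSum σ g (σ k) n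
  det-family nextColumn-det zero    g k = simplify (g 0)
    where
    simplify : ∀ a → 1ℤ * (a * 1ℤ) + 0ℤ ≡ a
    simplify = solve-∀
  det-family nextColumn-det (suc n) g k = begin
    det (suc (suc n)) M
      ≡⟨ det-hessenberg n M (col-0-0 k) (col-0-suc k ∘ toℕ) ⟩
    g 0 * det (suc n) (minor M zero) - det (suc n) (minor M (suc zero))
      ≡⟨ cong₂ (λ a b → g 0 * a - b) (det-cong (suc n) (minor-family-zero n g k)) (det-cong (suc n) (minor-family-one n g k)) ⟩
    g 0 * det (suc n) (family (nextColumn k) (σ k) (suc n)) - det (suc n) (family (g ∘ suc) (σ k) (suc n))
      ≡⟨ cong₂ (λ a b → g 0 * a - b)
           (trans (det-family nextColumn-det n (nextColumn k) (σ k)) (nextColumn-det k n))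
           (det-family nextColumn-det n (g ∘ suc) (σ k)) ⟩
    g 0 * + catalanPow (σ k) (suc n) - altSum σ (g ∘ suc) (σ (σ k)) n ∎
    where M = family g k (suc (suc n))

altSum-binomialRow-tail : ∀ k n → altSum suc (binomialRow k ∘ suc) (suc k) n ≡ + catalanPow k (suc n)
altSum-binomialRow-tail k n = altSum-tail suc (binomialRow k) k n refl (altSum-binomialRow k 0 (suc n))

altSum-diagonalBinomial-tail : ∀ b n →
  altSum (2 ℕ.+_) (diagonalBinomial b ∘ suc) (3 ℕ.+ b) n ≡ + catalanPow (suc b) (suc n)
altSum-diagonalBinomial-tail b n =
  altSum-tail (2 ℕ.+_) (diagonalBinomial b) (suc b) n refl (altSum-diagonalBinomial b 0 (suc n))

binomShift-suc : ∀ a i j → binomShift a (suc i) (suc j) ≡ binomShift a i j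
binomShift-suc a i j with suc j ℕ.≤? suc (suc i) | j ℕ.≤? suc i
... | yes _         | yes _ = refl
... | no _          | no _  = refl
... | yes (s≤s j≤)  | no j≰ = contradiction j≤ j≰
... | no 1+j≰       | yes j≤ = contradiction (s≤s j≤) 1+j≰

B-column : ℕ → ℕ → ℕ → ℤ
B-column k r c = binomShift (suc c ℕ.+ k) r (suc c)

B-column-shift : ∀ k r c → B-column k (suc r) (suc c) ≡ B-column (suc k) r c
B-column-shift k r c =
  trans (binomShift-suc _ r (suc c)) (cong (λ a → binomShift a r (suc c)) (sym (ℕₚ.+-suc (suc c) k)))

module BFamily = HessenbergFamily suc B-column (λ k → refl) (λ k c → refl) B-column-shift

det-B : ∀ k n → det n (B k n) ≡ + catalanPow k n
det-B k zero    = refl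
det-B k (suc n) = begin
  det (suc n) (B k (suc n))                                    ≡⟨ det-cong (suc n) B≗family ⟩
  det (suc n) (family (binomialRow k ∘ suc) k (suc n))         ≡⟨ det-family nextColumn-det n (binomialRow k ∘ suc) k ⟩
  altSum suc (binomialRow k ∘ suc) (suc k) n                   ≡⟨ altSum-binomialRow-tail k n ⟩
  + catalanPow k (suc n)                                       ∎
  where
  open BFamily
  B≗family : ∀ i j → B k (suc n) i j ≡ family (binomialRow k ∘ suc) k (suc n) i j
  B≗family i zero    = refl
  B≗family i (suc j) = refl
  nextColumn-det : ∀ k n → altSum suc (nextColumn k) (suc (suc k)) n ≡ + catalanPow (suc k) (suc n)
  nextColumn-det k = altSum-binomialRow-tail (suc k)

A-column : ℕ → ℕ → ℕ → ℤ
A-column k r c = binomShift (r ℕ.+ suc c ℕ.+ k) r (suc c)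

A-column-shift : ∀ k r c → A-column k (suc r) (suc c) ≡ A-column (2 ℕ.+ k) r c
A-column-shift k r c = trans (binomShift-suc _ r (suc c)) (cong (λ a → binomShift a r (suc c)) (reindex k r c))
  where
  reindex : ∀ k r c → suc r ℕ.+ suc (suc c) ℕ.+ k ≡ r ℕ.+ suc c ℕ.+ suc (suc k)
  reindex = ℕ-Solver.solve-∀

module AFamily = HessenbergFamily (2 ℕ.+_) A-column (λ k → refl) (λ k c → refl) A-column-shift

det-A : ∀ k n → det n (A (suc k) n) ≡ + catalanPow (suc k) n
det-A k zero    = refl
det-A k (suc n) = begin
  det (suc n) (A (suc k) (suc n))                    ≡⟨ det-cong (suc n) A≗family ⟩
  det (suc n) (family g (suc k) (suc n))             ≡⟨ det-family nextColumn-det n g (suc k) ⟩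
  altSum (2 ℕ.+_) g (3 ℕ.+ k) n                      ≡⟨ altSum-cong (2 ℕ.+_) g≗diagonal (3 ℕ.+ k) n ⟩
  altSum (2 ℕ.+_) (diagonalBinomial k ∘ suc) (3 ℕ.+ k) n ≡⟨ altSum-diagonalBinomial-tail k n ⟩
  + catalanPow (suc k) (suc n)                       ∎
  where
  open AFamily
  g : ℕ → ℤ
  g r = + ((r ℕ.+ 0 ℕ.+ suc k) C suc r)
  A≗family : ∀ i j → A (suc k) (suc n) i j ≡ family g (suc k) (suc n) i j
  A≗family i zero    = refl
  A≗family i (suc j) = refl
  g≗diagonal : ∀ r → g r ≡ diagonalBinomial k (suc r)
  g≗diagonal r = cong (λ a → + (a C suc r)) (trans (cong (ℕ._+ suc k) (ℕₚ.+-identityʳ r)) (ℕₚ.+-suc r k))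
  nextColumn-det : ∀ k n → altSum (2 ℕ.+_) (nextColumn k) (4 ℕ.+ k) n ≡ + catalanPow (2 ℕ.+ k) (suc n)
  nextColumn-det k n = trans
    (altSum-cong (2 ℕ.+_) (λ r → cong (λ a → + (suc a C suc r)) (ℕₚ.+-assoc r 1 k)) (4 ℕ.+ k) n)
    (altSum-diagonalBinomial-tail (suc k) n)

mainTheorem1 : (k n : ℕ) → 1 ≤ k →
    (det n (A k n) ≡ det n (B k n)) ×
    ((+ (2 ℕ.* n ℕ.+ k)) * det n (B k n) ≡ + (k ℕ.* ((2 ℕ.* n ℕ.+ k) C n)))
mainTheorem1 zero    n ()
mainTheorem1 (suc k) n _ = trans (det-A k n) (sym (det-B (suc k) n)) , (begin
  + (2 ℕ.* n ℕ.+ suc k) * det n (B (suc k) n)        ≡⟨ cong (+ (2 ℕ.* n ℕ.+ suc k) *_) (det-B (suc k) n) ⟩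
  + (2 ℕ.* n ℕ.+ suc k) * + catalanPow (suc k) n     ≡⟨ pos-* (2 ℕ.* n ℕ.+ suc k) (catalanPow (suc k) n) ⟨
  + ((2 ℕ.* n ℕ.+ suc k) ℕ.* catalanPow (suc k) n)   ≡⟨ cong +_ (catalanPow-closedForm (suc k) n) ⟩
  + (suc k ℕ.* ((2 ℕ.* n ℕ.+ suc k) C n))            ∎)
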